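{- Let $\lambda,\gamma>0$ and let $G=(V,E)$ be a $(\lambda,\gamma)$-supersaturated graph on $N$ vertices with average degree $D$. Let $t\ge1$ and let $\ell$ be an integer with $0<\ell<t$. Set \[\nu=\nu(\ell)=\max\left\{\left(1-\gamma\frac{D}{N}\right)^{\ell},\lambda\right\}.\] Then for every independent set $I$ of $G$ with $|I|=t$ there exist a subset $L\subseteq I$ with $|L|=\ell$ and a set $P(L)\subseteq V(G)$, depending only on $L$, with $|P(L)|\le\nu N$, $I\setminus L\subseteq P(L)$ and $L\cap P(L)=\emptyset$. In particular, the number of independent sets of $G$ of size exactly $t$ is at most $\binom{N}{\ell}\binom{\nu N}{t-\ell}$.
   Context: For $S\subseteq V(G)$, $e(S)$ is the number of edges inside $S$ and $e(G)$ the number of edges of $G$. $G$ is $(\lambda,\gamma)$-supersaturated if every $S\subseteq V(G)$ with $|S|\ge\lambda N$ satisfies $e(S)\ge\gamma(|S|/N)^2e(G)$. Floors are omitted where inessential (e.g. in $\binom{\nu N}{t-\ell}$).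
   Formalization: The parameters λ and γ of the supersaturation condition are taken to be positive rationals. -}

module Defs where

open import Data.Nat using (ℕ; zero; suc; NonZero) renaming (_<ᵇ_ to _<ℕᵇ_)
open import Data.Bool using (Bool; true; false; _∧_; not)
open import Data.Fin using (Fin; toℕ)
open import Data.List using (List; []; _∷_; length; filterᵇ; allFin; concatMap; map; _++_)
open import Data.Vec using (Vec; lookup; _∷_; [])
open import Data.Fin.Subset using (Subset; _∈_; ⊤)
open import Data.Product using (_×_; _,_)
open import Data.Integer using (+_)
open import Data.Rational using (ℚ; _/_; _*_; _≤_; 1ℚ)
open import Relation.Binary.PropositionalEquality using (_≡_)

record Graph (N : ℕ) : Set where
  field
    adj   : Fin N → Fin N → Bool
    sym   : ∀ i j → adj i j ≡ adj j i
    irref : ∀ i → adj i i ≡ false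
open Graph public

ℕtoℚ : ℕ → ℚ
ℕtoℚ n = (+ n) / 1

_^ℚ_ : ℚ → ℕ → ℚ
q ^ℚ zero  = 1ℚ
q ^ℚ suc n = q * (q ^ℚ n)

pairs : (N : ℕ) → List (Fin N × Fin N)
pairs N = concatMap (λ i → map (λ j → (i , j)) (allFin N)) (allFin N)

-- e(S): number of edges with both endpoints in S
-- (each edge {i,j} counted once, via the pair with toℕ i < toℕ j)
eIn : ∀ {N} → Graph N → Subset N → ℕ
eIn {N} G S = length (filterᵇ ok (pairs N))
  where
  ok : Fin N × Fin N → Bool
  ok (i , j) = (toℕ i <ℕᵇ toℕ j) ∧ lookup S i ∧ lookup S j ∧ adj G i j

eG : ∀ {N} → Graph N → ℕ
eG G = eIn G ⊤

avgDeg : ∀ {N} .{{_ : NonZero N}} → Graph N → ℚ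
avgDeg {N} G = (+ (2 Data.Nat.* eG G)) / N

Supersaturated : ∀ {N} .{{_ : NonZero N}} → ℚ → ℚ → Graph N → Set
Supersaturated {N} lam gam G =
  ∀ (S : Subset N) → lam * ℕtoℚ N ≤ ℕtoℚ (Data.Fin.Subset.∣ S ∣) →
    gam * ((((+ Data.Fin.Subset.∣ S ∣) / N) ^ℚ 2) * ℕtoℚ (eG G)) ≤ ℕtoℚ (eIn G S)

Independent : ∀ {N} → Graph N → Subset N → Set
Independent G I = ∀ i j → i ∈ I → j ∈ I → adj G i j ≡ false

allᵇ : {A : Set} → (A → Bool) → List A → Bool
allᵇ p [] = true
allᵇ p (x ∷ xs) = p x ∧ allᵇ p xs

independentᵇ : ∀ {N} → Graph N → Subset N → Bool
independentᵇ {N} G I = allᵇ (λ { (i , j) → not (lookup I i ∧ lookup I j ∧ adj G i j) }) (pairs N)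

allSubsets : (N : ℕ) → List (Subset N)
allSubsets zero = [] ∷ []
allSubsets (suc N) = map (true ∷_) (allSubsets N) ++ map (false ∷_) (allSubsets N)

numIndep : ∀ {N} → Graph N → ℕ → ℕ
numIndep {N} G t =
  length (filterᵇ (λ I → independentᵇ G I ∧ (Data.Fin.Subset.∣ I ∣ Data.Nat.≡ᵇ t)) (allSubsets N))

module Submission where

-- A fingerprint L ⊆ V drives a greedy algorithm: start with A = V and,
-- while A meets L, take a vertex v of maximum degree in G[A]; if v ∈ L delete
-- v and its neighbours, otherwise delete v alone.  The final set P(L) depends
-- only on L.  For an independent set I, the first ℓ chosen vertices lying in I
-- form a fingerprint L ⊆ I with I ∖ L ⊆ P(L) and L ∩ P(L) = ∅.  While
-- |A| ≥ λN, supersaturation and the handshake lemma show that the maximum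
-- degree is at least 2e(A)/|A| ≥ γ(D/N)|A|, so each neighbourhood deletion
-- multiplies |A| by at most 1 - γD/N; hence |P(L)| ≤ max((1-γD/N)^ℓ, λ)N = νN.
-- Finally every independent t-set is a t-set of an interval [L, L ∪ P(L)]
-- with |L| = ℓ, and such an interval has at most C(νN, t-ℓ) of them.

open import Defs hiding (sym)
open import Data.Nat using (ℕ)

module FiniteSums where

  open import Data.Bool using (Bool; true; false; _∧_; not)
  open import Data.Empty using (⊥)
  open import Data.Fin using (Fin; zero; suc; _≟_)
  open import Data.Fin.Subset using (Subset; ∣_∣)
  open import Data.List using (List; []; _∷_; _++_; map; concat; tabulate; allFin; length; filterᵇ)
  open import Data.List.Membership.Propositional using (_∈_)
  open import Data.List.Membership.Propositional.Properties using (∈-allFin; ∈-map⁺; ∈-concat⁺′)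
  open import Data.List.Relation.Unary.Any using (here; there)
  open import Data.Nat using (zero; suc; _+_; _*_; _≤_; z≤n)
  open import Data.Nat.Properties using (+-*-semiring; +-commutativeSemigroup; +-assoc; +-mono-≤; *-distribʳ-+; ≤-refl)
  open import Data.Product using (∃-syntax; _×_; _,_)
  import Data.Product as Product
  open import Data.Vec using ([]; _∷_; lookup)
  open import Function using (_∘_; id)
  open import Relation.Nullary using (does)
  open import Relation.Binary.PropositionalEquality using (_≡_; refl; sym; trans; cong; cong₂; module ≡-Reasoning)

  open import Algebra.Properties.Semiring.Sum +-*-semiring using (sum; sum-replicate-zero; sum-cong-≗) public
  open import Algebra.Properties.CommutativeSemigroup +-commutativeSemigroup using (interchange)

  𝟙 : Bool → ℕ
  𝟙 true  = 1
  𝟙 false = 0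

  𝟙≤1 : ∀ b → 𝟙 b ≤ 1
  𝟙≤1 true  = ≤-refl
  𝟙≤1 false = z≤n

  𝟙-∧-≤ : ∀ a b → 𝟙 (a ∧ b) ≤ 𝟙 b
  𝟙-∧-≤ true  b = ≤-refl
  𝟙-∧-≤ false b = z≤n

  𝟙-split : ∀ a b → 𝟙 (a ∧ not b) + 𝟙 (a ∧ b) ≡ 𝟙 a
  𝟙-split true  true  = refl
  𝟙-split true  false = refl
  𝟙-split false b     = refl

  true≠false : ∀ {b} → b ≡ true → b ≡ false → ⊥
  true≠false refl ()

  ∧-true-left : ∀ {a b} → a ∧ b ≡ true → a ≡ true
  ∧-true-left {true} _ = refl

  ∧-true-right : ∀ {a b} → a ∧ b ≡ true → b ≡ true
  ∧-true-right {true} b≡true = b≡true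

  sum-mono : ∀ {n} {f g : Fin n → ℕ} → (∀ i → f i ≤ g i) → sum f ≤ sum g
  sum-mono {zero}  f≤g = z≤n
  sum-mono {suc n} f≤g = +-mono-≤ (f≤g zero) (sum-mono (f≤g ∘ suc))

  sum-witness : ∀ {n} (p : Fin n → Bool) → 1 ≤ sum (𝟙 ∘ p) → ∃[ i ] p i ≡ true
  sum-witness {suc n} p pos with p zero in p₀
  ... | true  = zero , p₀
  ... | false = Product.map suc id (sum-witness (p ∘ suc) pos)

  sum-point : ∀ {n} (v : Fin n) → sum (λ i → 𝟙 (does (i ≟ v))) ≡ 1
  sum-point {suc n} zero    = cong suc (sum-replicate-zero n)
  sum-point {suc n} (suc v) = sum-point v

  ∣∣≡sum : ∀ {n} (S : Subset n) → ∣ S ∣ ≡ sum (𝟙 ∘ lookup S)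
  ∣∣≡sum []          = refl
  ∣∣≡sum (true ∷ S)  = cong suc (∣∣≡sum S)
  ∣∣≡sum (false ∷ S) = ∣∣≡sum S

  ∑ₗ : {A : Set} → List A → (A → ℕ) → ℕ
  ∑ₗ []       f = 0
  ∑ₗ (x ∷ xs) f = f x + ∑ₗ xs f

  module _ {A : Set} where

    ∑ₗ-++ : (xs ys : List A) (f : A → ℕ) → ∑ₗ (xs ++ ys) f ≡ ∑ₗ xs f + ∑ₗ ys f
    ∑ₗ-++ []       ys f = refl
    ∑ₗ-++ (x ∷ xs) ys f = trans (cong (f x +_) (∑ₗ-++ xs ys f)) (sym (+-assoc (f x) _ _))

    ∑ₗ-map : {B : Set} (g : B → A) (xs : List B) (f : A → ℕ) → ∑ₗ (map g xs) f ≡ ∑ₗ xs (f ∘ g)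
    ∑ₗ-map g []       f = refl
    ∑ₗ-map g (x ∷ xs) f = cong (f (g x) +_) (∑ₗ-map g xs f)

    ∑ₗ-concat : (xss : List (List A)) (f : A → ℕ) → ∑ₗ (concat xss) f ≡ ∑ₗ xss (λ xs → ∑ₗ xs f)
    ∑ₗ-concat []         f = refl
    ∑ₗ-concat (xs ∷ xss) f = trans (∑ₗ-++ xs (concat xss) f) (cong (∑ₗ xs f +_) (∑ₗ-concat xss f))

    ∑ₗ-tabulate : ∀ {n} (h : Fin n → A) (f : A → ℕ) → ∑ₗ (tabulate h) f ≡ sum (f ∘ h)
    ∑ₗ-tabulate {zero}  h f = refl
    ∑ₗ-tabulate {suc n} h f = cong (f (h zero) +_) (∑ₗ-tabulate (h ∘ suc) f)

    ∑ₗ-mono : (xs : List A) {f g : A → ℕ} → (∀ x → f x ≤ g x) → ∑ₗ xs f ≤ ∑ₗ xs g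
    ∑ₗ-mono []       f≤g = z≤n
    ∑ₗ-mono (x ∷ xs) f≤g = +-mono-≤ (f≤g x) (∑ₗ-mono xs f≤g)

    ∑ₗ-cong : (xs : List A) {f g : A → ℕ} → (∀ x → f x ≡ g x) → ∑ₗ xs f ≡ ∑ₗ xs g
    ∑ₗ-cong []       f≡g = refl
    ∑ₗ-cong (x ∷ xs) f≡g = cong₂ _+_ (f≡g x) (∑ₗ-cong xs f≡g)

    ∑ₗ-zero : (xs : List A) → ∑ₗ xs (λ _ → 0) ≡ 0
    ∑ₗ-zero []       = refl
    ∑ₗ-zero (x ∷ xs) = ∑ₗ-zero xs

    ∑ₗ-vanish : (xs : List A) {f : A → ℕ} → (∀ x → f x ≡ 0) → ∑ₗ xs f ≡ 0
    ∑ₗ-vanish xs f≡0 = trans (∑ₗ-cong xs f≡0) (∑ₗ-zero xs)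

    ∑ₗ-distrib-+ : (xs : List A) (f g : A → ℕ) → ∑ₗ xs (λ x → f x + g x) ≡ ∑ₗ xs f + ∑ₗ xs g
    ∑ₗ-distrib-+ []       f g = refl
    ∑ₗ-distrib-+ (x ∷ xs) f g =
      trans (cong (f x + g x +_) (∑ₗ-distrib-+ xs f g)) (interchange (f x) (g x) (∑ₗ xs f) (∑ₗ xs g))

    ∑ₗ-*ʳ : (xs : List A) (f : A → ℕ) (c : ℕ) → ∑ₗ xs (λ x → f x * c) ≡ ∑ₗ xs f * c
    ∑ₗ-*ʳ []       f c = refl
    ∑ₗ-*ʳ (x ∷ xs) f c = trans (cong (f x * c +_) (∑ₗ-*ʳ xs f c)) (sym (*-distribʳ-+ c (f x) _))

  ∑ₗ-comm : {A B : Set} (xs : List A) (ys : List B) (f : A → B → ℕ) →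
    ∑ₗ xs (λ x → ∑ₗ ys (f x)) ≡ ∑ₗ ys (λ y → ∑ₗ xs (λ x → f x y))
  ∑ₗ-comm []       ys f = sym (∑ₗ-zero ys)
  ∑ₗ-comm (x ∷ xs) ys f =
    trans (cong (∑ₗ ys (f x) +_) (∑ₗ-comm xs ys f)) (sym (∑ₗ-distrib-+ ys (f x) _))

  -- The length of a Boolean filter is a sum of indicators; this is how the
  -- counts e(S) and numIndep of Defs are read.
  length-filter : {A : Set} (p : A → Bool) (xs : List A) → length (filterᵇ p xs) ≡ ∑ₗ xs (𝟙 ∘ p)
  length-filter p []       = refl
  length-filter p (x ∷ xs) with p x
  ... | true  = cong suc (length-filter p xs)
  ... | false = length-filter p xs

  ∑ₗ-pairs : ∀ n (f : Fin n × Fin n → ℕ) → ∑ₗ (pairs n) f ≡ sum (λ i → sum (λ j → f (i , j)))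
  ∑ₗ-pairs n f = begin
    ∑ₗ (concat (map row (allFin n))) f          ≡⟨ ∑ₗ-concat (map row (allFin n)) f ⟩
    ∑ₗ (map row (allFin n)) (λ ps → ∑ₗ ps f)    ≡⟨ ∑ₗ-map row (allFin n) (λ ps → ∑ₗ ps f) ⟩
    ∑ₗ (allFin n) (λ i → ∑ₗ (row i) f)          ≡⟨ ∑ₗ-tabulate id (λ i → ∑ₗ (row i) f) ⟩
    sum (λ i → ∑ₗ (row i) f)                     ≡⟨ sum-cong-≗ rowSum ⟩
    sum (λ i → sum (λ j → f (i , j)))            ∎
    where
    open ≡-Reasoning
    row : Fin n → List (Fin n × Fin n)
    row i = map (i ,_) (allFin n)
    rowSum : ∀ i → ∑ₗ (row i) f ≡ sum (λ j → f (i , j))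
    rowSum i = trans (∑ₗ-map (i ,_) (allFin n) f) (∑ₗ-tabulate id (λ j → f (i , j)))

  pair∈pairs : ∀ {n} (i j : Fin n) → (i , j) ∈ pairs n
  pair∈pairs {n} i j = ∈-concat⁺′ (∈-map⁺ (i ,_) (∈-allFin j)) (∈-map⁺ (λ i → map (i ,_) (allFin n)) (∈-allFin i))

  allᵇ-∈ : {A : Set} (q : A → Bool) {x : A} {xs : List A} → allᵇ q xs ≡ true → x ∈ xs → q x ≡ true
  allᵇ-∈ q {xs = y ∷ ys} all (here refl) = ∧-true-left all
  allᵇ-∈ q {xs = y ∷ ys} all (there x∈ys) with q y
  ... | true = allᵇ-∈ q all x∈ys

module BooleanSubsets where

  open FiniteSums
  open import Data.Bool using (Bool; true; false; _∧_; _∨_; if_then_else_)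
  open import Data.Bool.Properties using (∨-identityʳ; ∨-zeroʳ)
  open import Data.Empty using (⊥-elim)
  open import Data.Fin using (Fin; zero; suc; _≟_)
  open import Data.Fin.Subset using (Subset; ∣_∣; _─_)
  open import Data.Maybe using (Maybe; just; nothing)
  open import Data.Nat using (zero; suc; _+_; _≤_; _≤ᵇ_)
  open import Data.Nat.Properties using (≤ᵇ-reflects-≤; ≤-refl; ≤-trans; <⇒≤; ≰⇒>; +-comm; +-identityʳ)
  open import Data.Product using (_×_; _,_)
  open import Data.Sum using (_⊎_; inj₁; inj₂)
  open import Data.Vec using (_∷_; lookup; tabulate)
  open import Data.Vec.Properties using (lookup∘tabulate; tabulate∘lookup; tabulate-cong)
  open import Function using (_∘_)
  open import Relation.Nullary using (yes; no; does)
  open import Relation.Nullary.Reflects using (ofʸ; ofⁿ)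
  open import Relation.Binary.PropositionalEquality using (_≡_; _≢_; refl; sym; trans; cong; cong₂; module ≡-Reasoning)
  open import Algebra.Properties.Semiring.Sum Data.Nat.Properties.+-*-semiring using (∑-distrib-+)

  subset-ext : ∀ {n} (X Y : Subset n) → (∀ i → lookup X i ≡ lookup Y i) → X ≡ Y
  subset-ext X Y same = trans (sym (tabulate∘lookup X)) (trans (tabulate-cong same) (tabulate∘lookup Y))

  lookup-─ : ∀ {n} (I L : Subset n) i → lookup (I ─ L) i ≡ true → lookup I i ≡ true × lookup L i ≡ false
  lookup-─ (a ∷ I) (true ∷ L)  zero    ()
  lookup-─ (a ∷ I) (false ∷ L) zero    e = e , refl
  lookup-─ (a ∷ I) (b ∷ L)     (suc i) e = lookup-─ I L i e

  ∣tabulate∣ : ∀ {n} (g : Fin n → Bool) → ∣ tabulate g ∣ ≡ sum (𝟙 ∘ g)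
  ∣tabulate∣ g = trans (∣∣≡sum (tabulate g)) (sum-cong-≗ (cong 𝟙 ∘ lookup∘tabulate g))

  restrict : ∀ {n} → Subset n → (Fin n → Bool) → Subset n
  restrict A h = tabulate (λ i → lookup A i ∧ h i)

  lookup-restrict : ∀ {n} (A : Subset n) h i → lookup (restrict A h) i ≡ (lookup A i ∧ h i)
  lookup-restrict A h = lookup∘tabulate (λ i → lookup A i ∧ h i)

  restrict-⊆ : ∀ {n} (A : Subset n) h i → lookup (restrict A h) i ≡ true → lookup A i ≡ true
  restrict-⊆ A h i e = ∧-true-left (trans (sym (lookup-restrict A h i)) e)

  insert : ∀ {n} → Subset n → Fin n → Subset n
  insert S v = tabulate (λ i → lookup S i ∨ does (i ≟ v))

  lookup-insert : ∀ {n} (S : Subset n) v i → lookup (insert S v) i ≡ (lookup S i ∨ does (i ≟ v))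
  lookup-insert S v = lookup∘tabulate (λ i → lookup S i ∨ does (i ≟ v))

  insert-here : ∀ {n} (S : Subset n) v → lookup (insert S v) v ≡ true
  insert-here S v rewrite lookup-insert S v v with v ≟ v
  ... | yes _  = ∨-zeroʳ (lookup S v)
  ... | no v≢v = ⊥-elim (v≢v refl)

  insert-elsewhere : ∀ {n} (S : Subset n) {v i} → i ≢ v → lookup (insert S v) i ≡ lookup S i
  insert-elsewhere S {v} {i} i≢v rewrite lookup-insert S v i with i ≟ v
  ... | yes i≡v = ⊥-elim (i≢v i≡v)
  ... | no _    = ∨-identityʳ (lookup S i)

  insert-cases : ∀ {n} (S : Subset n) v i → lookup (insert S v) i ≡ true → lookup S i ≡ true ⊎ i ≡ v
  insert-cases S v i e with i ≟ v
  ... | yes i≡v = inj₂ i≡v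
  ... | no i≢v  = inj₁ (trans (sym (insert-elsewhere S i≢v)) e)

  insert-size : ∀ {n} (S : Subset n) v → lookup S v ≡ false → ∣ insert S v ∣ ≡ suc ∣ S ∣
  insert-size S v Sv = begin
    ∣ insert S v ∣                                       ≡⟨ ∣tabulate∣ (λ i → lookup S i ∨ does (i ≟ v)) ⟩
    sum (λ i → 𝟙 (lookup S i ∨ does (i ≟ v)))            ≡⟨ sum-cong-≗ pointwise ⟩
    sum (λ i → 𝟙 (lookup S i) + 𝟙 (does (i ≟ v)))        ≡⟨ ∑-distrib-+ (𝟙 ∘ lookup S) (λ i → 𝟙 (does (i ≟ v))) ⟩
    sum (𝟙 ∘ lookup S) + sum (λ i → 𝟙 (does (i ≟ v)))    ≡⟨ cong₂ _+_ (sym (∣∣≡sum S)) (sum-point v) ⟩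
    ∣ S ∣ + 1                                             ≡⟨ +-comm ∣ S ∣ 1 ⟩
    suc ∣ S ∣                                             ∎
    where
    open ≡-Reasoning
    pointwise : ∀ i → 𝟙 (lookup S i ∨ does (i ≟ v)) ≡ 𝟙 (lookup S i) + 𝟙 (does (i ≟ v))
    pointwise i with i ≟ v
    ... | yes refl rewrite Sv = refl
    ... | no _     = trans (cong 𝟙 (∨-identityʳ (lookup S i))) (sym (+-identityʳ _))

  anyᵇ : ∀ {n} → (Fin n → Bool) → Bool
  anyᵇ {zero}  p = false
  anyᵇ {suc n} p = p zero ∨ anyᵇ (p ∘ suc)

  anyᵇ-intro : ∀ {n} (p : Fin n → Bool) i → p i ≡ true → anyᵇ p ≡ true
  anyᵇ-intro p zero    pi = cong (_∨ anyᵇ (p ∘ suc)) pi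
  anyᵇ-intro p (suc i) pi = trans (cong (p zero ∨_) (anyᵇ-intro (p ∘ suc) i pi)) (∨-zeroʳ (p zero))

  anyᵇ-none : ∀ {n} (p : Fin n → Bool) → (∀ i → p i ≡ false) → anyᵇ p ≡ false
  anyᵇ-none {zero}  p allFalse = refl
  anyᵇ-none {suc n} p allFalse = cong₂ _∨_ (allFalse zero) (anyᵇ-none (p ∘ suc) (allFalse ∘ suc))

  anyᵇ-cong : ∀ {n} {p q : Fin n → Bool} → (∀ i → p i ≡ q i) → anyᵇ p ≡ anyᵇ q
  anyᵇ-cong {zero}  p≡q = refl
  anyᵇ-cong {suc n} p≡q = cong₂ _∨_ (p≡q zero) (anyᵇ-cong (p≡q ∘ suc))

  data ArgMax {n} (p : Fin n → Bool) (f : Fin n → ℕ) : Maybe (Fin n) → Set where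
    none : (∀ i → p i ≡ false) → ArgMax p f nothing
    best : ∀ {v} → p v ≡ true → (∀ u → p u ≡ true → f u ≤ f v) → ArgMax p f (just v)

  argmax : ∀ {n} → (Fin n → Bool) → (Fin n → ℕ) → Maybe (Fin n)
  argmax {zero}  p f = nothing
  argmax {suc n} p f with argmax (p ∘ suc) (f ∘ suc)
  ... | nothing = if p zero then just zero else nothing
  ... | just k  = if p zero ∧ (f (suc k) ≤ᵇ f zero) then just zero else just (suc k)

  argmax-spec : ∀ {n} (p : Fin n → Bool) (f : Fin n → ℕ) → ArgMax p f (argmax p f)
  argmax-spec {zero}  p f = none (λ ())
  argmax-spec {suc n} p f with argmax (p ∘ suc) (f ∘ suc) | argmax-spec (p ∘ suc) (f ∘ suc)
  ... | nothing | none rest with p zero in p₀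
  ...   | true  = best p₀ λ { zero _ → ≤-refl ; (suc u) pu → ⊥-elim (true≠false pu (rest u)) }
  ...   | false = none λ { zero → p₀ ; (suc u) → rest u }
  argmax-spec {suc n} p f | just k | best pk maxk
    with p zero in p₀ | f (suc k) ≤ᵇ f zero | ≤ᵇ-reflects-≤ (f (suc k)) (f zero)
  ... | true  | true  | ofʸ k≤0 = best p₀ λ { zero _ → ≤-refl ; (suc u) pu → ≤-trans (maxk u pu) k≤0 }
  ... | true  | false | ofⁿ k≰0 = best pk λ { zero _ → <⇒≤ (≰⇒> k≰0) ; (suc u) pu → maxk u pu }
  ... | false | _     | _       = best pk λ { zero pu → ⊥-elim (true≠false pu p₀) ; (suc u) pu → maxk u pu }

  argmax-just : ∀ {n} (p : Fin n → Bool) (f : Fin n → ℕ) {v} → argmax p f ≡ just v →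
    p v ≡ true × (∀ u → p u ≡ true → f u ≤ f v)
  argmax-just p f eq with argmax p f | argmax-spec p f
  argmax-just p f refl | just v | best pv maxv = pv , maxv

module IntervalCounting where

  open FiniteSums
  open import Data.Bool using (Bool; true; false; _∧_; _∨_; not)
  open import Data.Bool.Properties using (∧-zeroʳ; T-≡)
  open import Data.Empty using (⊥-elim)
  open import Data.Fin using (zero; suc)
  open import Data.Fin.Subset using (Subset; ∣_∣; _∪_)
  open import Data.List using (List; map)
  open import Data.Nat using (zero; suc; _+_; _*_; _∸_; _≤_; _<_; _≡ᵇ_; z≤n; _≤?_)
  open import Data.Nat.Combinatorics using (_C_; nCk+nC[k+1]≡[n+1]C[k+1])
  open import Data.Nat.Properties
    using (≤-refl; ≤-reflexive; ≤-trans; ≤-pred; <⇒≤; ≰⇒>; +-mono-≤; +-suc; +-identityʳ; m≤m+n; m≤n+m;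
           m+[n∸m]≡n; *-identityˡ; *-identityʳ; *-zeroʳ; ≡ᵇ⇒≡; ≡⇒≡ᵇ; module ≤-Reasoning)
  open import Data.Product using (∃-syntax; _×_; _,_)
  open import Data.Vec using ([]; _∷_; lookup)
  open import Function using (_∘_; Equivalence)
  open import Relation.Nullary using (yes; no)
  open import Relation.Binary.PropositionalEquality using (_≡_; refl; sym; trans; cong; cong₂; subst)

  ∑ₗ-allSubsets-suc : ∀ {n} (f : Subset (suc n) → ℕ) →
    ∑ₗ (allSubsets (suc n)) f ≡ ∑ₗ (allSubsets n) (f ∘ (true ∷_)) + ∑ₗ (allSubsets n) (f ∘ (false ∷_))
  ∑ₗ-allSubsets-suc {n} f =
    trans (∑ₗ-++ (map (true ∷_) (allSubsets n)) (map (false ∷_) (allSubsets n)) f)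
          (cong₂ _+_ (∑ₗ-map (true ∷_) (allSubsets n) f) (∑ₗ-map (false ∷_) (allSubsets n) f))

  term≤∑ₗ-allSubsets : ∀ {n} (f : Subset n → ℕ) S → f S ≤ ∑ₗ (allSubsets n) f
  term≤∑ₗ-allSubsets {zero}  f []        = m≤m+n (f []) 0
  term≤∑ₗ-allSubsets {suc n} f (b ∷ S) = ≤-trans (head b) (≤-reflexive (sym (∑ₗ-allSubsets-suc f)))
    where
    head : ∀ b → f (b ∷ S) ≤ ∑ₗ (allSubsets n) (f ∘ (true ∷_)) + ∑ₗ (allSubsets n) (f ∘ (false ∷_))
    head true  = ≤-trans (term≤∑ₗ-allSubsets (f ∘ (true ∷_)) S) (m≤m+n _ _)
    head false = ≤-trans (term≤∑ₗ-allSubsets (f ∘ (false ∷_)) S) (m≤n+m _ _)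

  count-size : ∀ n k → ∑ₗ (allSubsets n) (λ S → 𝟙 (∣ S ∣ ≡ᵇ k)) ≡ n C k
  count-size zero    zero    = refl
  count-size zero    (suc k) = refl
  count-size (suc n) zero    =
    trans (∑ₗ-allSubsets-suc {n} (λ S → 𝟙 (∣ S ∣ ≡ᵇ 0))) (cong₂ _+_ (∑ₗ-zero (allSubsets n)) (count-size n 0))
  count-size (suc n) (suc k) =
    trans (∑ₗ-allSubsets-suc {n} (λ S → 𝟙 (∣ S ∣ ≡ᵇ suc k)))
          (trans (cong₂ _+_ (count-size n k) (count-size n (suc k))) (nCk+nC[k+1]≡[n+1]C[k+1] n k))

  C-monoˡ : ∀ {n m} k → n ≤ m → n C k ≤ m C k
  C-monoˡ {n} {m} k n≤m = subst (λ x → n C k ≤ x C k) (m+[n∸m]≡n n≤m) (grow (m ∸ n))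
    where
    grow : ∀ o → n C k ≤ (n + o) C k
    grow zero    = ≤-reflexive (cong (_C k) (sym (+-identityʳ n)))
    grow (suc o) = ≤-trans (grow o) (subst (λ x → (n + o) C k ≤ x C k) (sym (+-suc n o)) (step (n + o) k))
      where
      step : ∀ x k → x C k ≤ suc x C k
      step x zero    = ≤-refl
      step x (suc k) = subst (x C suc k ≤_) (nCk+nC[k+1]≡[n+1]C[k+1] x k) (m≤n+m _ _)

  ≡ᵇ-refl : ∀ n → (n ≡ᵇ n) ≡ true
  ≡ᵇ-refl n = Equivalence.to T-≡ (≡⇒≡ᵇ n n refl)

  ≡ᵇ-true⇒≡ : ∀ {m n} → (m ≡ᵇ n) ≡ true → m ≡ n
  ≡ᵇ-true⇒≡ {m} {n} e = ≡ᵇ⇒≡ m n (Equivalence.from T-≡ e)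

  _⊆ᵇ_ : ∀ {n} → Subset n → Subset n → Bool
  []      ⊆ᵇ []      = true
  (x ∷ X) ⊆ᵇ (y ∷ Y) = (not x ∨ y) ∧ (X ⊆ᵇ Y)

  ⊆ᵇ-intro : ∀ {n} (X Y : Subset n) → (∀ i → lookup X i ≡ true → lookup Y i ≡ true) → (X ⊆ᵇ Y) ≡ true
  ⊆ᵇ-intro []          []      X⊆Y = refl
  ⊆ᵇ-intro (true ∷ X)  (y ∷ Y) X⊆Y rewrite X⊆Y zero refl = ⊆ᵇ-intro X Y (λ i → X⊆Y (suc i))
  ⊆ᵇ-intro (false ∷ X) (y ∷ Y) X⊆Y = ⊆ᵇ-intro X Y (λ i → X⊆Y (suc i))

  inInterval : ∀ {n} → Subset n → Subset n → ℕ → Subset n → Bool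
  inInterval L P t S = (L ⊆ᵇ S) ∧ (S ⊆ᵇ (L ∪ P)) ∧ (∣ S ∣ ≡ᵇ t)

  -- The number of t-sets in [L, L ∪ P], and of (t-1)-sets (none when t = 0).
  intervalCount : ∀ {n} → Subset n → Subset n → ℕ → ℕ
  intervalCount {n} L P t = ∑ₗ (allSubsets n) (𝟙 ∘ inInterval L P t)

  intervalCount⁻ : ∀ {n} → Subset n → Subset n → ℕ → ℕ
  intervalCount⁻ L P zero    = 0
  intervalCount⁻ L P (suc t) = intervalCount L P t

  Disjoint : ∀ {n} → Subset n → Subset n → Set
  Disjoint L P = ∀ i → lookup L i ≡ true → lookup P i ≡ false

  ∧∧-false : ∀ a b → (a ∧ b ∧ false) ≡ false
  ∧∧-false a b = trans (cong (a ∧_) (∧-zeroʳ b)) (∧-zeroʳ a)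

  -- The three possible roles of the first point when L and P are disjoint:
  -- forced into S (in L), free (in P), or excluded (in neither).
  interval-forced : ∀ {n} (L P : Subset n) t → intervalCount (true ∷ L) (false ∷ P) t ≡ intervalCount⁻ L P t
  interval-forced {n} L P t = trans (∑ₗ-allSubsets-suc (𝟙 ∘ inInterval (true ∷ L) (false ∷ P) t))
                                    (trans (cong₂ _+_ (with-point t) (∑ₗ-zero (allSubsets n))) (+-identityʳ _))
    where
    with-point : ∀ t →
      ∑ₗ (allSubsets n) (λ S → 𝟙 (inInterval (true ∷ L) (false ∷ P) t (true ∷ S))) ≡ intervalCount⁻ L P t
    with-point zero    = ∑ₗ-vanish (allSubsets n) (λ S → cong 𝟙 (∧∧-false (L ⊆ᵇ S) (S ⊆ᵇ (L ∪ P))))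
    with-point (suc t) = refl

  interval-free : ∀ {n} (L P : Subset n) t →
    intervalCount (false ∷ L) (true ∷ P) t ≡ intervalCount⁻ L P t + intervalCount L P t
  interval-free {n} L P t = trans (∑ₗ-allSubsets-suc (𝟙 ∘ inInterval (false ∷ L) (true ∷ P) t))
                                  (cong (_+ intervalCount L P t) (with-point t))
    where
    with-point : ∀ t →
      ∑ₗ (allSubsets n) (λ S → 𝟙 (inInterval (false ∷ L) (true ∷ P) t (true ∷ S))) ≡ intervalCount⁻ L P t
    with-point zero    = ∑ₗ-vanish (allSubsets n) (λ S → cong 𝟙 (∧∧-false (L ⊆ᵇ S) (S ⊆ᵇ (L ∪ P))))
    with-point (suc t) = refl

  interval-excluded : ∀ {n} (L P : Subset n) t → intervalCount (false ∷ L) (false ∷ P) t ≡ intervalCount L P t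
  interval-excluded {n} L P t =
    trans (∑ₗ-allSubsets-suc (𝟙 ∘ inInterval (false ∷ L) (false ∷ P) t))
          (cong (_+ intervalCount L P t) (∑ₗ-vanish (allSubsets n) (λ S → cong 𝟙 (∧-zeroʳ (L ⊆ᵇ S)))))

  interval-empty : ∀ {n} (L P : Subset n) t → Disjoint L P → t < ∣ L ∣ → intervalCount L P t ≡ 0
  interval-empty⁻ : ∀ {n} (L P : Subset n) t → Disjoint L P → t ≤ ∣ L ∣ → intervalCount⁻ L P t ≡ 0
  interval-empty⁻ L P zero    disj t≤ = refl
  interval-empty⁻ L P (suc t) disj t≤ = interval-empty L P t disj t≤
  interval-empty []          []          t disj ()
  interval-empty (true ∷ L)  (true ∷ P)  t disj t< = ⊥-elim (true≠false refl (disj zero refl))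
  interval-empty (true ∷ L)  (false ∷ P) t disj t< =
    trans (interval-forced L P t) (interval-empty⁻ L P t (λ i → disj (suc i)) (≤-pred t<))
  interval-empty (false ∷ L) (true ∷ P)  t disj t< =
    trans (interval-free L P t) (cong₂ _+_ (interval-empty⁻ L P t (λ i → disj (suc i)) (<⇒≤ t<))
                                           (interval-empty L P t (λ i → disj (suc i)) t<))
  interval-empty (false ∷ L) (false ∷ P) t disj t< =
    trans (interval-excluded L P t) (interval-empty L P t (λ i → disj (suc i)) t<)

  -- A set of size |L| + k in [L, L ∪ P] is L together with a k-subset of P.
  interval-bound : ∀ {n} (L P : Subset n) k → Disjoint L P → intervalCount L P (∣ L ∣ + k) ≤ ∣ P ∣ C k
  interval-bound []          []          zero    disj = ≤-refl
  interval-bound []          []          (suc k) disj = z≤n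
  interval-bound (true ∷ L)  (true ∷ P)  k       disj = ⊥-elim (true≠false refl (disj zero refl))
  interval-bound (true ∷ L)  (false ∷ P) k       disj =
    ≤-trans (≤-reflexive (interval-forced L P (suc (∣ L ∣ + k)))) (interval-bound L P k (λ i → disj (suc i)))
  interval-bound (false ∷ L) (true ∷ P)  zero    disj = begin
    intervalCount (false ∷ L) (true ∷ P) (∣ L ∣ + 0)                ≡⟨ interval-free L P (∣ L ∣ + 0) ⟩
    intervalCount⁻ L P (∣ L ∣ + 0) + intervalCount L P (∣ L ∣ + 0)  ≡⟨ cong (_+ intervalCount L P (∣ L ∣ + 0)) none-smaller ⟩
    intervalCount L P (∣ L ∣ + 0)                                   ≤⟨ interval-bound L P 0 (λ i → disj (suc i)) ⟩
    1                                                               ∎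
    where
    open ≤-Reasoning
    none-smaller : intervalCount⁻ L P (∣ L ∣ + 0) ≡ 0
    none-smaller = interval-empty⁻ L P _ (λ i → disj (suc i)) (≤-reflexive (+-identityʳ _))
  interval-bound (false ∷ L) (true ∷ P)  (suc k) disj = begin
    intervalCount (false ∷ L) (true ∷ P) (∣ L ∣ + suc k)
      ≡⟨ interval-free L P (∣ L ∣ + suc k) ⟩
    intervalCount⁻ L P (∣ L ∣ + suc k) + intervalCount L P (∣ L ∣ + suc k)
      ≡⟨ cong (λ t → intervalCount⁻ L P t + intervalCount L P (∣ L ∣ + suc k)) (+-suc ∣ L ∣ k) ⟩
    intervalCount L P (∣ L ∣ + k) + intervalCount L P (∣ L ∣ + suc k)
      ≤⟨ +-mono-≤ (interval-bound L P k (λ i → disj (suc i))) (interval-bound L P (suc k) (λ i → disj (suc i))) ⟩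
    ∣ P ∣ C k + ∣ P ∣ C suc k
      ≡⟨ nCk+nC[k+1]≡[n+1]C[k+1] ∣ P ∣ k ⟩
    suc ∣ P ∣ C suc k
      ∎
    where open ≤-Reasoning
  interval-bound (false ∷ L) (false ∷ P) k       disj =
    ≤-trans (≤-reflexive (interval-excluded L P (∣ L ∣ + k))) (interval-bound L P k (λ i → disj (suc i)))

  interval-count : ∀ {n} (L P : Subset n) t m → Disjoint L P → ∣ P ∣ ≤ m → intervalCount L P t ≤ m C (t ∸ ∣ L ∣)
  interval-count L P t m disj ∣P∣≤m with ∣ L ∣ ≤? t
  ... | yes ∣L∣≤t = ≤-trans (subst (λ x → intervalCount L P x ≤ ∣ P ∣ C (t ∸ ∣ L ∣)) (m+[n∸m]≡n ∣L∣≤t)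
                                   (interval-bound L P (t ∸ ∣ L ∣) disj))
                            (C-monoˡ (t ∸ ∣ L ∣) ∣P∣≤m)
  ... | no  ∣L∣≰t = ≤-trans (≤-reflexive (interval-empty L P t disj (≰⇒> ∣L∣≰t))) z≤n

  count-by-fingerprints : ∀ n (p : Subset n → Bool) (P : Subset n → Subset n) ℓ t m →
    (∀ L → ∣ P L ∣ ≤ m) → (∀ L → Disjoint L (P L)) →
    (∀ S → p S ≡ true → ∃[ L ] ∣ L ∣ ≡ ℓ × inInterval L (P L) t S ≡ true) →
    ∑ₗ (allSubsets n) (𝟙 ∘ p) ≤ (n C ℓ) * (m C (t ∸ ℓ))
  count-by-fingerprints n p P ℓ t m small disj covered = begin
    ∑ₗ Ω (𝟙 ∘ p)                                    ≤⟨ ∑ₗ-mono Ω covered-once ⟩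
    ∑ₗ Ω (λ S → ∑ₗ Ω (λ L → weight L S))            ≡⟨ ∑ₗ-comm Ω Ω (λ S L → weight L S) ⟩
    ∑ₗ Ω (λ L → ∑ₗ Ω (λ S → weight L S))            ≡⟨ ∑ₗ-cong Ω (λ L → ∑ₗ-*ʳ Ω (𝟙 ∘ inInterval L (P L) t) (sized L)) ⟩
    ∑ₗ Ω (λ L → intervalCount L (P L) t * sized L)  ≤⟨ ∑ₗ-mono Ω per-fingerprint ⟩
    ∑ₗ Ω (λ L → sized L * (m C (t ∸ ℓ)))            ≡⟨ ∑ₗ-*ʳ Ω sized (m C (t ∸ ℓ)) ⟩
    ∑ₗ Ω sized * (m C (t ∸ ℓ))                      ≡⟨ cong (_* (m C (t ∸ ℓ))) (count-size n ℓ) ⟩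
    (n C ℓ) * (m C (t ∸ ℓ))                         ∎
    where
    open ≤-Reasoning
    Ω : List (Subset n)
    Ω = allSubsets n
    sized : Subset n → ℕ
    sized L = 𝟙 (∣ L ∣ ≡ᵇ ℓ)
    weight : Subset n → Subset n → ℕ
    weight L S = 𝟙 (inInterval L (P L) t S) * sized L
    covered-once : ∀ S → 𝟙 (p S) ≤ ∑ₗ Ω (λ L → weight L S)
    covered-once S with p S in pS
    ... | false = z≤n
    ... | true with covered S pS
    ...   | L , ∣L∣≡ℓ , S∈[L] = ≤-trans (≤-reflexive weight≡1) (term≤∑ₗ-allSubsets (λ L → weight L S) L)
      where
      weight≡1 : 1 ≡ weight L S
      weight≡1 rewrite S∈[L] | ∣L∣≡ℓ | ≡ᵇ-refl ℓ = refl
    per-fingerprint : ∀ L → intervalCount L (P L) t * sized L ≤ sized L * (m C (t ∸ ℓ))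
    per-fingerprint L with ∣ L ∣ ≡ᵇ ℓ in eq
    ... | false = ≤-reflexive (*-zeroʳ (intervalCount L (P L) t))
    ... | true  = begin
      intervalCount L (P L) t * 1   ≡⟨ *-identityʳ _ ⟩
      intervalCount L (P L) t       ≤⟨ interval-count L (P L) t m (disj L) (small L) ⟩
      m C (t ∸ ∣ L ∣)               ≡⟨ cong (λ x → m C (t ∸ x)) (≡ᵇ-true⇒≡ {∣ L ∣} {ℓ} eq) ⟩
      m C (t ∸ ℓ)                   ≡⟨ *-identityˡ _ ⟨
      1 * (m C (t ∸ ℓ))             ∎

module Greedy {N : ℕ} (G : Graph N) where

  open FiniteSums
  open BooleanSubsets
  open IntervalCounting
  open import Data.Bool using (Bool; true; false; _∧_; _∨_; not; if_then_else_)
  open import Data.Bool.Properties using (¬-not; ∧-zeroʳ; ∧-identityʳ; T-≡)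
  open import Data.Empty using (⊥-elim)
  open import Data.Fin using (Fin; zero; suc; _≟_; toℕ)
  open import Data.Fin.Subset using (Subset; ∣_∣; ⊥; ⊤; _⊆_; _─_; _∩_; _∪_)
  open import Data.Fin.Subset.Properties using (∣⊥∣≡0; ∣⊤∣≡n)
  open import Data.Maybe using (Maybe; just; nothing; maybe′)
  open import Data.Nat using (zero; suc; _+_; _*_; _∸_; _≤_; _≤ᵇ_; _<ᵇ_; _≡ᵇ_; z≤n; s≤s)
  open import Data.Nat.Combinatorics using (_C_)
  open import Data.Nat.Properties
    using (n≮0; m<m+n; n≤1+n; *-identityˡ; <ᵇ-reflects-<; ≤ᵇ⇒≤; ≤⇒≤ᵇ; ≤-refl; ≤-reflexive; ≤-trans; ≤-pred; <-asym;
           +-comm; +-suc; +-identityʳ; m≤n+m; module ≤-Reasoning)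
  open import Data.Product using (Σ; ∃-syntax; _×_; _,_; proj₁; proj₂)
  open import Data.Sum using ([_,_])
  open import Data.Vec using (lookup)
  open import Data.Vec.Properties using (lookup-zipWith; lookup-replicate; lookup⇒[]=; []=⇒lookup)
  open import Function using (_∘_; Equivalence)
  open import Relation.Nullary using (yes; no; does)
  open import Relation.Nullary.Reflects using (ofʸ)
  open import Relation.Binary.PropositionalEquality
    using (_≡_; _≢_; refl; sym; trans; cong; cong₂; subst; subst₂; module ≡-Reasoning)
  open import Algebra.Properties.Semiring.Sum Data.Nat.Properties.+-*-semiring
    using (∑-distrib-+; ∑-comm; *-distribʳ-sum)

  deg : Subset N → Fin N → ℕ
  deg A v = sum (λ j → 𝟙 (lookup A j ∧ adj G v j))

  deleteVertex : Subset N → Fin N → Subset N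
  deleteVertex A v = restrict A (λ i → not (does (i ≟ v)))

  deleteNbhd : Subset N → Fin N → Subset N
  deleteNbhd A v = restrict A (λ i → not (does (i ≟ v)) ∧ not (adj G v i))

  choose : Subset N → Subset N → Maybe (Fin N)
  choose L A = if anyᵇ (λ i → lookup A i ∧ lookup L i) then argmax (lookup A) (deg A) else nothing

  update : Subset N → Subset N → Fin N → Subset N
  update L A v = if lookup L v then deleteNbhd A v else deleteVertex A v

  run : ℕ → Subset N → Subset N → Subset N
  run zero    L A = A
  run (suc f) L A = maybe′ (λ v → run f L (update L A v)) A (choose L A)

  update-⊆ : ∀ L A v i → lookup (update L A v) i ≡ true → lookup A i ≡ true
  update-⊆ L A v i with lookup L v
  ... | true  = restrict-⊆ A _ i
  ... | false = restrict-⊆ A _ i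

  run-⊆ : ∀ f L A i → lookup (run f L A) i ≡ true → lookup A i ≡ true
  run-⊆ zero    L A i e = e
  run-⊆ (suc f) L A i with choose L A
  ... | nothing = λ e → e
  ... | just v  = λ e → update-⊆ L A v i (run-⊆ f L (update L A v) i e)

  run-stop : ∀ f L A → choose L A ≡ nothing → run (suc f) L A ≡ A
  run-stop f L A = cong (maybe′ (λ v → run f L (update L A v)) A)

  run-step : ∀ f L A {v} → choose L A ≡ just v → run (suc f) L A ≡ run f L (update L A v)
  run-step f L A = cong (maybe′ (λ v → run f L (update L A v)) A)

  choose-stop : ∀ L A → (∀ i → (lookup A i ∧ lookup L i) ≡ false) → choose L A ≡ nothing
  choose-stop L A disjoint =
    cong (λ b → if b then argmax (lookup A) (deg A) else nothing) (anyᵇ-none _ disjoint)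

  choose-max : ∀ L A u {v} → lookup A u ≡ true → lookup L u ≡ true →
    argmax (lookup A) (deg A) ≡ just v → choose L A ≡ just v
  choose-max L A u Au Lu max =
    trans (cong (λ b → if b then argmax (lookup A) (deg A) else nothing)
                (anyᵇ-intro _ u (cong₂ _∧_ Au Lu)))
          max

  choose-∈ : ∀ L A {v} → choose L A ≡ just v → lookup A v ≡ true
  choose-∈ L A eq with anyᵇ (λ i → lookup A i ∧ lookup L i)
  ... | true = proj₁ (argmax-just (lookup A) (deg A) eq)

  run-empty : ∀ f A → run f ⊥ A ≡ A
  run-empty zero    A = refl
  run-empty (suc f) A = run-stop f ⊥ A (choose-stop ⊥ A outside)
    where
    outside : ∀ i → (lookup A i ∧ lookup ⊥ i) ≡ false
    outside i rewrite lookup-replicate i false = ∧-zeroʳ (lookup A i)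

  Agree : Subset N → Subset N → Subset N → Set
  Agree A L₁ L₂ = ∀ i → lookup A i ≡ true → lookup L₁ i ≡ lookup L₂ i

  run-cong : ∀ f A L₁ L₂ → Agree A L₁ L₂ → run f L₁ A ≡ run f L₂ A
  run-cong zero    A L₁ L₂ agree = refl
  run-cong (suc f) A L₁ L₂ agree = by-choice (choose L₂ A) refl
    where
    sameChoice : choose L₁ A ≡ choose L₂ A
    sameChoice = cong (λ b → if b then argmax (lookup A) (deg A) else nothing) (anyᵇ-cong meet)
      where
      meet : ∀ i → (lookup A i ∧ lookup L₁ i) ≡ (lookup A i ∧ lookup L₂ i)
      meet i with lookup A i in Ai
      ... | true  = agree i Ai
      ... | false = refl
    by-choice : ∀ m → choose L₂ A ≡ m → run (suc f) L₁ A ≡ run (suc f) L₂ A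
    by-choice nothing  eq = trans (run-stop f L₁ A (trans sameChoice eq)) (sym (run-stop f L₂ A eq))
    by-choice (just v) eq = begin
      run (suc f) L₁ A           ≡⟨ run-step f L₁ A (trans sameChoice eq) ⟩
      run f L₁ (update L₁ A v)   ≡⟨ cong (λ b → run f L₁ (if b then deleteNbhd A v else deleteVertex A v)) (agree v Av) ⟩
      run f L₁ (update L₂ A v)   ≡⟨ run-cong f (update L₂ A v) L₁ L₂ (λ i e → agree i (update-⊆ L₂ A v i e)) ⟩
      run f L₂ (update L₂ A v)   ≡⟨ run-step f L₂ A eq ⟨
      run (suc f) L₂ A           ∎
      where
      open ≡-Reasoning
      Av : lookup A v ≡ true
      Av = choose-∈ L₂ A eq

  lookup-deleteNbhd : ∀ A v i → lookup (deleteNbhd A v) i ≡ (lookup A i ∧ not (does (i ≟ v)) ∧ not (adj G v i))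
  lookup-deleteNbhd A v = lookup-restrict A (λ i → not (does (i ≟ v)) ∧ not (adj G v i))

  v∉deleteNbhd : ∀ A v → lookup (deleteNbhd A v) v ≡ false
  v∉deleteNbhd A v rewrite lookup-deleteNbhd A v v with v ≟ v
  ... | yes _  = ∧-zeroʳ (lookup A v)
  ... | no v≢v = ⊥-elim (v≢v refl)

  in-deleteNbhd : ∀ A v i → lookup A i ≡ true → i ≢ v → adj G v i ≡ false → lookup (deleteNbhd A v) i ≡ true
  in-deleteNbhd A v i Ai i≢v v≁i rewrite lookup-deleteNbhd A v i | Ai | v≁i with i ≟ v
  ... | yes i≡v = ⊥-elim (i≢v i≡v)
  ... | no _    = refl

  in-deleteVertex : ∀ A v i → lookup A i ≡ true → i ≢ v → lookup (deleteVertex A v) i ≡ true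
  in-deleteVertex A v i Ai i≢v rewrite lookup-restrict A (λ i → not (does (i ≟ v))) i | Ai with i ≟ v
  ... | yes i≡v = ⊥-elim (i≢v i≡v)
  ... | no _    = refl

  deleteVertex-size : ∀ A v → lookup A v ≡ true → suc ∣ deleteVertex A v ∣ ≤ ∣ A ∣
  deleteVertex-size A v Av = begin
    suc ∣ deleteVertex A v ∣                      ≡⟨ cong suc (∣tabulate∣ keep) ⟩
    1 + sum (𝟙 ∘ keep)                            ≡⟨ cong (_+ sum (𝟙 ∘ keep)) (sum-point v) ⟨
    sum point + sum (𝟙 ∘ keep)                    ≡⟨ ∑-distrib-+ point (𝟙 ∘ keep) ⟨
    sum (λ i → point i + 𝟙 (keep i))              ≤⟨ sum-mono pointwise ⟩
    sum (𝟙 ∘ lookup A)                            ≡⟨ ∣∣≡sum A ⟨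
    ∣ A ∣                                         ∎
    where
    open ≤-Reasoning
    keep : Fin N → Bool
    keep i = lookup A i ∧ not (does (i ≟ v))
    point : Fin N → ℕ
    point i = 𝟙 (does (i ≟ v))
    pointwise : ∀ i → point i + 𝟙 (keep i) ≤ 𝟙 (lookup A i)
    pointwise i with i ≟ v
    ... | yes refl rewrite Av = ≤-refl
    ... | no _     = ≤-reflexive (cong 𝟙 (∧-identityʳ (lookup A i)))

  deleteNbhd-size : ∀ A v → lookup A v ≡ true → ∣ deleteNbhd A v ∣ + suc (deg A v) ≤ ∣ A ∣
  deleteNbhd-size A v Av = begin
    ∣ deleteNbhd A v ∣ + suc (deg A v)                  ≡⟨ cong₂ _+_ (∣tabulate∣ keep) (cong (_+ deg A v) (sym (sum-point v))) ⟩
    sum (𝟙 ∘ keep) + (sum point + sum nbr)              ≡⟨ cong (sum (𝟙 ∘ keep) +_) (∑-distrib-+ point nbr) ⟨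
    sum (𝟙 ∘ keep) + sum (λ i → point i + nbr i)        ≡⟨ ∑-distrib-+ (𝟙 ∘ keep) (λ i → point i + nbr i) ⟨
    sum (λ i → 𝟙 (keep i) + (point i + nbr i))          ≤⟨ sum-mono pointwise ⟩
    sum (𝟙 ∘ lookup A)                                  ≡⟨ ∣∣≡sum A ⟨
    ∣ A ∣                                               ∎
    where
    open ≤-Reasoning
    keep : Fin N → Bool
    keep i = lookup A i ∧ not (does (i ≟ v)) ∧ not (adj G v i)
    point nbr : Fin N → ℕ
    point i = 𝟙 (does (i ≟ v))
    nbr i = 𝟙 (lookup A i ∧ adj G v i)
    pointwise : ∀ i → 𝟙 (keep i) + (point i + nbr i) ≤ 𝟙 (lookup A i)
    pointwise i with i ≟ v
    ... | yes refl rewrite Av | irref G v = ≤-refl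
    ... | no _     = ≤-reflexive (𝟙-split (lookup A i) (adj G v i))

  -- One step of the run when the maximum-degree vertex v of A is a new
  -- fingerprint vertex: its closed neighbourhood goes, and the rest of the
  -- run no longer sees v.
  run-insert : ∀ f A L v → argmax (lookup A) (deg A) ≡ just v →
    run (suc f) (insert L v) A ≡ run f L (deleteNbhd A v)
  run-insert f A L v max = begin
    run (suc f) (insert L v) A                          ≡⟨ run-step f (insert L v) A chosen ⟩
    run f (insert L v) (update (insert L v) A v)        ≡⟨ cong (run f (insert L v) ∘ choice) (insert-here L v) ⟩
    run f (insert L v) (deleteNbhd A v)                 ≡⟨ run-cong f (deleteNbhd A v) (insert L v) L agree ⟩
    run f L (deleteNbhd A v)                            ∎
    where
    open ≡-Reasoning
    choice : Bool → Subset N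
    choice b = if b then deleteNbhd A v else deleteVertex A v
    chosen : choose (insert L v) A ≡ just v
    chosen = choose-max (insert L v) A v (proj₁ (argmax-just (lookup A) (deg A) max)) (insert-here L v) max
    agree : Agree (deleteNbhd A v) (insert L v) L
    agree i A′i = insert-elsewhere L (λ { refl → true≠false A′i (v∉deleteNbhd A v) })

  run-skip : ∀ f A L v u → lookup A u ≡ true → lookup L u ≡ true → lookup L v ≡ false →
    argmax (lookup A) (deg A) ≡ just v → run (suc f) L A ≡ run f L (deleteVertex A v)
  run-skip f A L v u Au Lu Lv max = begin
    run (suc f) L A           ≡⟨ run-step f L A (choose-max L A u Au Lu max) ⟩
    run f L (update L A v)    ≡⟨ cong (λ b → run f L (if b then deleteNbhd A v else deleteVertex A v)) Lv ⟩
    run f L (deleteVertex A v) ∎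
    where open ≡-Reasoning

  independent-adj : ∀ {I} → Independent G I → ∀ {i j} → lookup I i ≡ true → lookup I j ≡ true → adj G i j ≡ false
  independent-adj {I} indep {i} {j} Ii Ij = indep i j (lookup⇒[]= i I Ii) (lookup⇒[]= j I Ij)

  common : Subset N → Subset N → ℕ
  common I A = sum (λ i → 𝟙 (lookup I i ∧ lookup A i))

  common-≤ : ∀ I A → common I A ≤ ∣ A ∣
  common-≤ I A = subst (common I A ≤_) (sym (∣∣≡sum A)) (sum-mono (λ i → 𝟙-∧-≤ (lookup I i) (lookup A i)))

  common-⊤ : ∀ I → common I ⊤ ≡ ∣ I ∣
  common-⊤ I = trans (sum-cong-≗ pointwise) (sym (∣∣≡sum I))
    where
    pointwise : ∀ i → 𝟙 (lookup I i ∧ lookup (⊤ {N}) i) ≡ 𝟙 (lookup I i)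
    pointwise i rewrite lookup-replicate i true = cong 𝟙 (∧-identityʳ (lookup I i))

  common-deleteNbhd : ∀ I A v → Independent G I → lookup I v ≡ true →
    common I A ≤ common I (deleteNbhd A v) + 1
  common-deleteNbhd I A v indep Iv = begin
    common I A                                  ≤⟨ sum-mono pointwise ⟩
    sum (λ i → inI′ i + point i)                ≡⟨ ∑-distrib-+ inI′ point ⟩
    common I (deleteNbhd A v) + sum point       ≡⟨ cong (common I (deleteNbhd A v) +_) (sum-point v) ⟩
    common I (deleteNbhd A v) + 1               ∎
    where
    open ≤-Reasoning
    inI′ : Fin N → ℕ
    inI′ i = 𝟙 (lookup I i ∧ lookup (deleteNbhd A v) i)
    point : Fin N → ℕ
    point i = 𝟙 (does (i ≟ v))
    pointwise : ∀ i → 𝟙 (lookup I i ∧ lookup A i) ≤ inI′ i + point i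
    pointwise i with i ≟ v
    ... | yes refl = ≤-trans (𝟙≤1 _) (m≤n+m 1 _)
    ... | no i≢v with lookup I i in Ii | lookup A i in Ai
    ...   | false | _     = z≤n
    ...   | true  | false = z≤n
    ...   | true  | true  rewrite in-deleteNbhd A v i Ai i≢v (independent-adj indep Iv Ii) = ≤-refl

  common-deleteVertex : ∀ I A v → lookup I v ≡ false → common I A ≤ common I (deleteVertex A v)
  common-deleteVertex I A v Iv = sum-mono pointwise
    where
    pointwise : ∀ i → 𝟙 (lookup I i ∧ lookup A i) ≤ 𝟙 (lookup I i ∧ lookup (deleteVertex A v) i)
    pointwise i with lookup I i in Ii | lookup A i in Ai
    ... | false | _     = z≤n
    ... | true  | false = z≤n
    ... | true  | true  rewrite in-deleteVertex A v i Ai (λ { refl → true≠false Ii Iv }) = ≤-refl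

  edgeIn : Subset N → Fin N → Fin N → Bool
  edgeIn A i j = lookup A i ∧ lookup A j ∧ adj G i j

  edgeIn-sym : ∀ A i j → edgeIn A i j ≡ edgeIn A j i
  edgeIn-sym A i j with lookup A i | lookup A j
  ... | true  | true  = Graph.sym G i j
  ... | true  | false = refl
  ... | false | true  = refl
  ... | false | false = refl

  one-order : ∀ (i j : Fin N) b → 𝟙 ((toℕ i <ᵇ toℕ j) ∧ b) + 𝟙 ((toℕ j <ᵇ toℕ i) ∧ b) ≤ 𝟙 b
  one-order i j b with toℕ i <ᵇ toℕ j | <ᵇ-reflects-< (toℕ i) (toℕ j) | toℕ j <ᵇ toℕ i | <ᵇ-reflects-< (toℕ j) (toℕ i)
  ... | true  | ofʸ i<j | true  | ofʸ j<i = ⊥-elim (<-asym i<j j<i)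
  ... | true  | _       | false | _       = ≤-reflexive (+-identityʳ (𝟙 b))
  ... | false | _       | c     | _       = 𝟙-∧-≤ c b

  handshake : ∀ A M → (∀ u → lookup A u ≡ true → deg A u ≤ M) → 2 * eIn G A ≤ ∣ A ∣ * M
  handshake A M maxDeg = begin
    2 * eIn G A                                         ≡⟨ cong (2 *_) edges ⟩
    E< + (E< + 0)                                       ≡⟨ cong (E< +_) (trans (+-identityʳ E<) E<≡E>) ⟩
    E< + E>                                             ≡⟨ ∑-distrib-+ (sum ∘ forward) (sum ∘ backward) ⟨
    sum (λ i → sum (forward i) + sum (backward i))      ≡⟨ sum-cong-≗ (λ i → ∑-distrib-+ (forward i) (backward i)) ⟨
    sum (λ i → sum (λ j → forward i j + backward i j))  ≤⟨ sum-mono (λ i → sum-mono (λ j → one-order i j (edgeIn A i j))) ⟩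
    sum (λ i → sum (λ j → 𝟙 (edgeIn A i j)))            ≤⟨ sum-mono row ⟩
    sum (λ i → 𝟙 (lookup A i) * M)                      ≡⟨ *-distribʳ-sum M (𝟙 ∘ lookup A) ⟨
    sum (𝟙 ∘ lookup A) * M                              ≡⟨ cong (_* M) (∣∣≡sum A) ⟨
    ∣ A ∣ * M                                           ∎
    where
    open ≤-Reasoning
    -- Each edge ij of G[A] is counted once, as i < j, in e(A).
    forward backward : Fin N → Fin N → ℕ
    forward  i j = 𝟙 ((toℕ i <ᵇ toℕ j) ∧ edgeIn A i j)
    backward i j = 𝟙 ((toℕ j <ᵇ toℕ i) ∧ edgeIn A i j)
    E< E> : ℕ
    E< = sum (sum ∘ forward)
    E> = sum (sum ∘ backward)
    edges : eIn G A ≡ E<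
    edges = trans (length-filter _ (pairs N)) (∑ₗ-pairs N (λ ij → forward (proj₁ ij) (proj₂ ij)))
    E<≡E> : E< ≡ E>
    E<≡E> = trans (∑-comm forward)
                  (sum-cong-≗ (λ i → sum-cong-≗ (λ j → cong (λ b → 𝟙 ((toℕ j <ᵇ toℕ i) ∧ b)) (edgeIn-sym A j i))))
    row : ∀ i → sum (λ j → 𝟙 (edgeIn A i j)) ≤ 𝟙 (lookup A i) * M
    row i with lookup A i in Ai
    ... | true  = ≤-trans (maxDeg i Ai) (≤-reflexive (sym (*-identityˡ M)))
    ... | false = ≤-reflexive (sum-replicate-zero N)

  independentᵇ-sound : ∀ I → independentᵇ G I ≡ true → Independent G I
  independentᵇ-sound I test i j i∈I j∈I =
    no-edge (allᵇ-∈ _ test (pair∈pairs i j)) ([]=⇒lookup i∈I) ([]=⇒lookup j∈I)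
    where
    no-edge : ∀ {a b c} → not (a ∧ b ∧ c) ≡ true → a ≡ true → b ≡ true → c ≡ false
    no-edge {c = false} _ _ _ = refl
    no-edge {c = true} () refl refl

  maxDegreeVertex : ∀ A → 1 ≤ ∣ A ∣ → ∃[ v ] argmax (lookup A) (deg A) ≡ just v
  maxDegreeVertex A nonempty with argmax (lookup A) (deg A) | argmax-spec (lookup A) (deg A)
  ... | just v  | _          = v , refl
  ... | nothing | none empty =
    let (w , Aw) = sum-witness (lookup A) (subst (1 ≤_) (∣∣≡sum A) nonempty) in
    ⊥-elim (true≠false Aw (empty w))

  -- The construction of a fingerprint is parametrised by a notion of admissible
  -- size after j neighbourhood deletions: `Bound j a` must be inherited by
  -- smaller sets, and must pass from A to the set left after deleting the
  -- closed neighbourhood of a vertex of maximum degree.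
  module Fingerprints
    (Bound : ℕ → ℕ → Set)
    (Bound-mono : ∀ j a b → a ≤ b → Bound j b → Bound j a)
    (Bound-step : ∀ j A d a → Bound j ∣ A ∣ → 2 * eIn G A ≤ ∣ A ∣ * d → a + suc d ≤ ∣ A ∣ → Bound (suc j) a)
    where

    record Fingerprint (f : ℕ) (A I : Subset N) (k j : ℕ) (L : Subset N) : Set where
      field
        inI       : ∀ i → lookup L i ≡ true → lookup I i ≡ true
        inA       : ∀ i → lookup L i ≡ true → lookup A i ≡ true
        size      : ∣ L ∣ ≡ k
        survivors : ∀ i → lookup I i ≡ true → lookup A i ≡ true → lookup L i ≡ false → lookup (run f L A) i ≡ true
        excluded  : ∀ i → lookup L i ≡ true → lookup (run f L A) i ≡ false
        bounded   : Bound (j + k) ∣ run f L A ∣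

    empty-fingerprint : ∀ f A I j → Bound j ∣ A ∣ → Fingerprint f A I 0 j ⊥
    empty-fingerprint f A I j bound = record
      { inI       = λ i e → ⊥-elim (true≠false e (lookup-replicate i false))
      ; inA       = λ i e → ⊥-elim (true≠false e (lookup-replicate i false))
      ; size      = ∣⊥∣≡0 N
      ; survivors = λ i _ Ai _ → subst (λ S → lookup S i ≡ true) (sym (run-empty f A)) Ai
      ; excluded  = λ i e → ⊥-elim (true≠false e (lookup-replicate i false))
      ; bounded   = subst₂ Bound (sym (+-identityʳ j)) (cong ∣_∣ (sym (run-empty f A))) bound
      }

    extend-nbhd : ∀ f A I k j v L → Independent G I → lookup I v ≡ true → argmax (lookup A) (deg A) ≡ just v →
      Fingerprint f (deleteNbhd A v) I k (suc j) L → Fingerprint (suc f) A I (suc k) j (insert L v)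
    extend-nbhd f A I k j v L indep Iv max fp = record
      { inI       = λ i e → [ F.inI i , (λ { refl → Iv }) ] (insert-cases L v i e)
      ; inA       = λ i e → [ restrict-⊆ A _ i ∘ F.inA i , (λ { refl → Av }) ] (insert-cases L v i e)
      ; size      = trans (insert-size L v Lv) (cong suc F.size)
      ; survivors = survivors
      ; excluded  = excluded
      ; bounded   = subst₂ Bound (sym (+-suc j k)) (cong ∣_∣ (sym runEq)) F.bounded
      }
      where
      module F = Fingerprint fp
      A′ L⁺ : Subset N
      A′ = deleteNbhd A v
      L⁺ = insert L v
      Av : lookup A v ≡ true
      Av = proj₁ (argmax-just (lookup A) (deg A) max)
      Lv : lookup L v ≡ false
      Lv = ¬-not (λ e → true≠false (F.inA v e) (v∉deleteNbhd A v))
      runEq : run (suc f) L⁺ A ≡ run f L A′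
      runEq = run-insert f A L v max
      survivors : ∀ i → lookup I i ≡ true → lookup A i ≡ true → lookup L⁺ i ≡ false →
        lookup (run (suc f) L⁺ A) i ≡ true
      survivors i Ii Ai L⁺i = subst (λ S → lookup S i ≡ true) (sym runEq)
        (F.survivors i Ii (in-deleteNbhd A v i Ai i≢v (independent-adj indep Iv Ii))
                     (trans (sym (insert-elsewhere L i≢v)) L⁺i))
        where
        i≢v : i ≢ v
        i≢v refl = true≠false (insert-here L v) L⁺i
      excluded : ∀ i → lookup L⁺ i ≡ true → lookup (run (suc f) L⁺ A) i ≡ false
      excluded i e = subst (λ S → lookup S i ≡ false) (sym runEq) ([ F.excluded i , (λ { refl → v-gone }) ] (insert-cases L v i e))
        where
        v-gone : lookup (run f L A′) v ≡ false
        v-gone = ¬-not (λ e → true≠false (run-⊆ f L A′ v e) (v∉deleteNbhd A v))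

    extend-vertex : ∀ f A I k j v L → lookup I v ≡ false → argmax (lookup A) (deg A) ≡ just v →
      Fingerprint f (deleteVertex A v) I (suc k) j L → Fingerprint (suc f) A I (suc k) j L
    extend-vertex f A I k j v L Iv max fp = record
      { inI       = F.inI
      ; inA       = λ i → restrict-⊆ A _ i ∘ F.inA i
      ; size      = F.size
      ; survivors = λ i Ii Ai Li → subst (λ S → lookup S i ≡ true) (sym runEq)
                      (F.survivors i Ii (in-deleteVertex A v i Ai (λ { refl → true≠false Ii Iv })) Li)
      ; excluded  = λ i Li → subst (λ S → lookup S i ≡ false) (sym runEq) (F.excluded i Li)
      ; bounded   = subst (λ S → Bound (j + suc k) ∣ S ∣) (sym runEq) F.bounded
      }
      where
      module F = Fingerprint fp
      A′ : Subset N
      A′ = deleteVertex A v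
      Lv : lookup L v ≡ false
      Lv = ¬-not (λ e → true≠false (F.inI v e) Iv)
      -- L is nonempty, and its points lie in A, so the run does not stop at A.
      u∈L : ∃[ u ] lookup L u ≡ true
      u∈L = sum-witness (lookup L) (subst (1 ≤_) (trans (sym F.size) (∣∣≡sum L)) (s≤s z≤n))
      runEq : run (suc f) L A ≡ run f L A′
      runEq with u∈L
      ... | u , Lu = run-skip f A L v u (restrict-⊆ A _ u (F.inA u Lu)) Lu Lv max

    fingerprint : ∀ f A I k j → Independent G I → ∣ A ∣ ≤ f → k ≤ common I A → Bound j ∣ A ∣ →
      Σ (Subset N) (Fingerprint f A I k j)
    fingerprint f A I zero j indep fuel room bound = ⊥ , empty-fingerprint f A I j bound
    fingerprint zero A I (suc k) j indep fuel room bound =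
      ⊥-elim (n≮0 (≤-trans room (≤-trans (common-≤ I A) fuel)))
    fingerprint (suc f) A I (suc k) j indep fuel room bound
      with maxDegreeVertex A (≤-trans (s≤s z≤n) (≤-trans room (common-≤ I A)))
    ... | v , max with lookup I v in Iv
    ...   | true  = insert (proj₁ rest) v , extend-nbhd f A I k j v (proj₁ rest) indep Iv max (proj₂ rest)
      where
      -- v is taken into the fingerprint; the rest of the run sees one
      -- fewer vertex of I and one more neighbourhood deletion.
      A′ : Subset N
      A′ = deleteNbhd A v
      maximal : lookup A v ≡ true × (∀ u → lookup A u ≡ true → deg A u ≤ deg A v)
      maximal = argmax-just (lookup A) (deg A) max
      shrink : ∣ A′ ∣ + suc (deg A v) ≤ ∣ A ∣
      shrink = deleteNbhd-size A v (proj₁ maximal)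
      rest : Σ (Subset N) (Fingerprint f A′ I k (suc j))
      rest = fingerprint f A′ I k (suc j) indep
               (≤-pred (≤-trans (m<m+n ∣ A′ ∣ (s≤s z≤n)) (≤-trans shrink fuel)))
               (≤-pred (≤-trans room (≤-trans (common-deleteNbhd I A v indep Iv) (≤-reflexive (+-comm _ 1)))))
               (Bound-step j A (deg A v) ∣ A′ ∣ bound (handshake A (deg A v) (proj₂ maximal)) shrink)
    ...   | false = proj₁ rest , extend-vertex f A I k j v (proj₁ rest) Iv max (proj₂ rest)
      where
      A′ : Subset N
      A′ = deleteVertex A v
      shrink : suc ∣ A′ ∣ ≤ ∣ A ∣
      shrink = deleteVertex-size A v (proj₁ (argmax-just (lookup A) (deg A) max))
      rest : Σ (Subset N) (Fingerprint f A′ I (suc k) j)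
      rest = fingerprint f A′ I (suc k) j indep
               (≤-pred (≤-trans shrink fuel))
               (≤-trans room (common-deleteVertex I A v Iv))
               (Bound-mono j ∣ A′ ∣ ∣ A ∣ (≤-trans (n≤1+n _) shrink) bound)

    module Containers (Bound-init : Bound 0 N) (ℓ t m : ℕ) (ℓ≤t : ℓ ≤ t) (Bound⇒≤m : ∀ a → Bound ℓ a → a ≤ m) where

      final : Subset N → Subset N
      final L = run N L ⊤

      -- L gives a genuine container if its final set is small and avoids L.
      valid : Subset N → Bool
      valid L = (∣ final L ∣ ≤ᵇ m) ∧ not (anyᵇ (λ i → lookup L i ∧ lookup (final L) i))

      container : Subset N → Subset N
      container L = if valid L then final L else ⊥

      container-small : ∀ L → ∣ container L ∣ ≤ m
      container-small L with valid L in ok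
      ... | true  = ≤ᵇ⇒≤ _ _ (Equivalence.from T-≡ (∧-true-left ok))
      ... | false = ≤-trans (≤-reflexive (∣⊥∣≡0 N)) z≤n

      container-disjoint : ∀ L → Disjoint L (container L)
      container-disjoint L i Li with valid L in ok
      ... | false = lookup-replicate i false
      ... | true with lookup (final L) i in Fi
      ...   | false = refl
      ...   | true  = ⊥-elim (true≠false ok invalid)
        where
        invalid : valid L ≡ false
        invalid = trans (cong (λ b → (∣ final L ∣ ≤ᵇ m) ∧ not b) (anyᵇ-intro _ i (cong₂ _∧_ Li Fi))) (∧-zeroʳ _)

      fingerprint-of : ∀ I → Independent G I → ∣ I ∣ ≡ t →
        ∃[ L ] Fingerprint N ⊤ I ℓ 0 L × container L ≡ final L
      fingerprint-of I indep ∣I∣≡t = L , fp , cong (λ b → if b then final L else ⊥) valid-L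
        where
        found : Σ (Subset N) (Fingerprint N ⊤ I ℓ 0)
        found = fingerprint N ⊤ I ℓ 0 indep (≤-reflexive (∣⊤∣≡n N))
                  (subst (ℓ ≤_) (sym (trans (common-⊤ I) ∣I∣≡t)) ℓ≤t)
                  (subst (Bound 0) (sym (∣⊤∣≡n N)) Bound-init)
        L : Subset N
        L = proj₁ found
        fp : Fingerprint N ⊤ I ℓ 0 L
        fp = proj₂ found
        module F = Fingerprint fp
        valid-L : valid L ≡ true
        valid-L = cong₂ _∧_ (Equivalence.to T-≡ (≤⇒≤ᵇ (Bound⇒≤m _ F.bounded)))
                            (cong not (anyᵇ-none _ (λ i → outside i)))
          where
          outside : ∀ i → (lookup L i ∧ lookup (final L) i) ≡ false
          outside i with lookup L i in Li
          ... | true  = F.excluded i Li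
          ... | false = refl

      covers : ∀ I → Independent G I → ∣ I ∣ ≡ t →
        Σ (Subset N) (λ L → L ⊆ I × ∣ L ∣ ≡ ℓ × Bound ℓ ∣ container L ∣ ×
                            (I ─ L) ⊆ container L × L ∩ container L ≡ ⊥)
      covers I indep ∣I∣≡t =
        L , L⊆I , F.size , subst (λ S → Bound ℓ ∣ S ∣) (sym P≡final) F.bounded , I─L⊆P , L∩P≡⊥
        where
        found : ∃[ L ] Fingerprint N ⊤ I ℓ 0 L × container L ≡ final L
        found = fingerprint-of I indep ∣I∣≡t
        L : Subset N
        L = proj₁ found
        P≡final : container L ≡ final L
        P≡final = proj₂ (proj₂ found)
        module F = Fingerprint (proj₁ (proj₂ found))
        L⊆I : L ⊆ I
        L⊆I {i} i∈L = lookup⇒[]= i I (F.inI i ([]=⇒lookup i∈L))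
        I─L⊆P : (I ─ L) ⊆ container L
        I─L⊆P {i} i∈I─L with lookup-─ I L i ([]=⇒lookup i∈I─L)
        ... | Ii , Li = lookup⇒[]= i (container L)
                          (trans (cong (λ S → lookup S i) P≡final) (F.survivors i Ii (lookup-replicate i true) Li))
        L∩P≡⊥ : L ∩ container L ≡ ⊥
        L∩P≡⊥ = subset-ext (L ∩ container L) ⊥ (λ i → trans (lookup-zipWith _∧_ i L (container L))
                                                         (trans (disjoint i) (sym (lookup-replicate i false))))
          where
          disjoint : ∀ i → (lookup L i ∧ lookup (container L) i) ≡ false
          disjoint i with lookup L i in Li
          ... | true  = container-disjoint L i Li
          ... | false = refl

      count : numIndep G t ≤ (N C ℓ) * (m C (t ∸ ℓ))
      count = subst (_≤ (N C ℓ) * (m C (t ∸ ℓ))) (sym (length-filter _ (allSubsets N)))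
        (count-by-fingerprints N _ container ℓ t m container-small container-disjoint covered)
        where
        covered : ∀ S → (independentᵇ G S ∧ (∣ S ∣ ≡ᵇ t)) ≡ true →
          ∃[ L ] ∣ L ∣ ≡ ℓ × inInterval L (container L) t S ≡ true
        covered S test = L , F.size , cong₂ _∧_ L⊆S (cong₂ _∧_ S⊆L∪P (trans (cong (_≡ᵇ t) ∣S∣≡t) (≡ᵇ-refl t)))
          where
          ∣S∣≡t : ∣ S ∣ ≡ t
          ∣S∣≡t = ≡ᵇ-true⇒≡ (∧-true-right test)
          found : ∃[ L ] Fingerprint N ⊤ S ℓ 0 L × container L ≡ final L
          found = fingerprint-of S (independentᵇ-sound S (∧-true-left test)) ∣S∣≡t
          L : Subset N
          L = proj₁ found
          P≡final : container L ≡ final L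
          P≡final = proj₂ (proj₂ found)
          module F = Fingerprint (proj₁ (proj₂ found))
          L⊆S : (L ⊆ᵇ S) ≡ true
          L⊆S = ⊆ᵇ-intro L S F.inI
          S⊆L∪P : (S ⊆ᵇ (L ∪ container L)) ≡ true
          S⊆L∪P = ⊆ᵇ-intro S (L ∪ container L) in-union
            where
            in-union : ∀ i → lookup S i ≡ true → lookup (L ∪ container L) i ≡ true
            in-union i Si rewrite lookup-zipWith _∨_ i L (container L) | P≡final with lookup L i in Li
            ... | true  = refl
            ... | false = F.survivors i Si (lookup-replicate i true) Li

module RationalBounds where

  open import Data.Fin.Subset using (Subset; ∣_∣)
  open import Data.Integer as ℤ using (+_)
  import Data.Integer.Properties as ℤ
  import Data.Integer.Solver
  open import Data.Nat as ℕ using (suc)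
  import Data.Nat.DivMod as ℕ
  import Data.Nat.Properties as ℕ
  import Data.Nat.Coprimality as Coprimality
  open import Data.Rational
    using (ℚ; mkℚ; _+_; _*_; _-_; -_; _/_; _≤_; _<_; _⊔_; 0ℚ; 1ℚ; floor; toℚᵘ; *≤*; NonNegative; Positive;
           nonNegative; nonPositive; positive)
  open import Data.Rational.Properties
    using (toℚᵘ-injective; toℚᵘ-fromℚᵘ; toℚᵘ-homo-+; toℚᵘ-homo-*; toℚᵘ-cancel-≤; normalize-coprime; normalize-nonNeg;
           nonNegative⁻¹; positive⁻¹; nonNeg*nonNeg⇒nonNeg; ≤-trans; ≤-reflexive; <⇒≤; <-≤-trans; ≰⇒>; _≤?_;
           +-monoˡ-≤; +-monoʳ-≤; +-identityˡ; +-identityʳ; neg-antimono-≤; *-identityˡ; *-zeroʳ; *-assoc;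
           *-monoˡ-≤-nonNeg; *-monoʳ-≤-nonNeg; *-monoˡ-≤-nonPos; *-cancelˡ-≤-pos; ⊔-sel; p≤p⊔q; p≤q⊔p;
           module ≤-Reasoning)
  import Data.Rational.Solver
  import Data.Rational.Unnormalised as ℚᵘ
  import Data.Rational.Unnormalised.Properties as ℚᵘ
  open import Data.Sum using (inj₁; inj₂)
  open import Relation.Nullary using (Dec; yes; no)
  open import Relation.Binary.PropositionalEquality using (_≡_; refl; sym; trans; cong; subst; subst₂)

  module ℤ-Solver = Data.Integer.Solver.+-*-Solver
  module ℚ-Solver = Data.Rational.Solver.+-*-Solver

  ℕtoℚ≃ : ∀ n → toℚᵘ (ℕtoℚ n) ℚᵘ.≃ ℚᵘ.mkℚᵘ (+ n) 0
  ℕtoℚ≃ n = toℚᵘ-fromℚᵘ (ℚᵘ.mkℚᵘ (+ n) 0)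

  ℕtoℚ-+ : ∀ m n → ℕtoℚ (m ℕ.+ n) ≡ ℕtoℚ m + ℕtoℚ n
  ℕtoℚ-+ m n = toℚᵘ-injective (ℚᵘ.≃-trans (ℕtoℚ≃ (m ℕ.+ n)) (ℚᵘ.≃-trans integral
    (ℚᵘ.≃-sym (ℚᵘ.≃-trans (toℚᵘ-homo-+ (ℕtoℚ m) (ℕtoℚ n)) (ℚᵘ.+-cong (ℕtoℚ≃ m) (ℕtoℚ≃ n))))))
    where
    open ℤ-Solver
    integral : ℚᵘ.mkℚᵘ (+ (m ℕ.+ n)) 0 ℚᵘ.≃ (ℚᵘ.mkℚᵘ (+ m) 0 ℚᵘ.+ ℚᵘ.mkℚᵘ (+ n) 0)
    integral = ℚᵘ.*≡* (trans (cong (ℤ._* + 1) (ℤ.pos-+ m n))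
      (solve 2 (λ a b → (a :+ b) :* con (+ 1) := (a :* con (+ 1) :+ b :* con (+ 1)) :* con (+ 1)) refl (+ m) (+ n)))

  ℕtoℚ-* : ∀ m n → ℕtoℚ (m ℕ.* n) ≡ ℕtoℚ m * ℕtoℚ n
  ℕtoℚ-* m n = toℚᵘ-injective (ℚᵘ.≃-trans (ℕtoℚ≃ (m ℕ.* n)) (ℚᵘ.≃-trans integral
    (ℚᵘ.≃-sym (ℚᵘ.≃-trans (toℚᵘ-homo-* (ℕtoℚ m) (ℕtoℚ n)) (ℚᵘ.*-cong (ℕtoℚ≃ m) (ℕtoℚ≃ n))))))
    where
    integral : ℚᵘ.mkℚᵘ (+ (m ℕ.* n)) 0 ℚᵘ.≃ (ℚᵘ.mkℚᵘ (+ m) 0 ℚᵘ.* ℚᵘ.mkℚᵘ (+ n) 0)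
    integral = ℚᵘ.*≡* (cong (ℤ._* + 1) (ℤ.pos-* m n))

  ℕtoℚ-mono : ∀ {m n} → m ℕ.≤ n → ℕtoℚ m ≤ ℕtoℚ n
  ℕtoℚ-mono {m} {n} m≤n = toℚᵘ-cancel-≤ (ℚᵘ.≤-respʳ-≃ (ℚᵘ.≃-sym (ℕtoℚ≃ n))
    (ℚᵘ.≤-respˡ-≃ (ℚᵘ.≃-sym (ℕtoℚ≃ m)) (ℚᵘ.*≤* (ℤ.*-monoʳ-≤-nonNeg (+ 1) (ℤ.+≤+ m≤n)))))

  ℕtoℚ≥0 : ∀ n → 0ℚ ≤ ℕtoℚ n
  ℕtoℚ≥0 n = ℕtoℚ-mono {0} {n} ℕ.z≤n

  /N≡*1/N : ∀ {N} .{{_ : ℕ.NonZero N}} a → (+ a) / N ≡ ℕtoℚ a * ((+ 1) / N)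
  /N≡*1/N {suc N-1} a = toℚᵘ-injective (ℚᵘ.≃-trans (toℚᵘ-fromℚᵘ (ℚᵘ.mkℚᵘ (+ a) N-1)) (ℚᵘ.≃-trans integral
    (ℚᵘ.≃-sym (ℚᵘ.≃-trans (toℚᵘ-homo-* (ℕtoℚ a) ((+ 1) / suc N-1))
                            (ℚᵘ.*-cong (ℕtoℚ≃ a) (toℚᵘ-fromℚᵘ (ℚᵘ.mkℚᵘ (+ 1) N-1)))))))
    where
    open ℤ-Solver
    integral : ℚᵘ.mkℚᵘ (+ a) N-1 ℚᵘ.≃ (ℚᵘ.mkℚᵘ (+ a) 0 ℚᵘ.* ℚᵘ.mkℚᵘ (+ 1) N-1)
    integral = ℚᵘ.*≡* (trans (cong (λ d → + a ℤ.* + suc d) (ℕ.+-identityʳ N-1))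
                             (solve 2 (λ x y → x :* y := (x :* con (+ 1)) :* y) refl (+ a) (+ suc N-1)))

  floor-≥ : ∀ x y → ℕtoℚ x ≤ y → x ℕ.≤ ℤ.∣ floor y ∣
  floor-≥ x (mkℚ (+ k) d-1 _) x≤y with subst (_≤ _) (normalize-coprime (Coprimality.sym (Coprimality.1-coprimeTo x))) x≤y
  ... | *≤* x*d≤k*1 = subst (x ℕ.≤_) (cong ℤ.∣_∣ (sym (ℤ.*-identityˡ (+ (k ℕ./ suc d-1)))))
                            (subst (ℕ._≤ k ℕ./ suc d-1) (ℕ.m*n/n≡m x (suc d-1)) (ℕ./-monoˡ-≤ (suc d-1) x*d≤k))
    where
    x*d≤k : x ℕ.* suc d-1 ℕ.≤ k
    x*d≤k = subst (x ℕ.* suc d-1 ℕ.≤_) (ℕ.*-identityʳ k)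
              (ℤ.drop‿+≤+ (subst₂ ℤ._≤_ (sym (ℤ.pos-* x (suc d-1))) (sym (ℤ.pos-* k 1)) x*d≤k*1))
  floor-≥ x (mkℚ ℤ.-[1+ k ] d-1 _) x≤y with ≤-trans (ℕtoℚ≥0 x) x≤y
  ... | *≤* ()

  0≤* : ∀ {p q} → 0ℚ ≤ p → 0ℚ ≤ q → 0ℚ ≤ p * q
  0≤* {p} {q} 0≤p 0≤q = nonNegative⁻¹ (p * q) {{nonNeg*nonNeg⇒nonNeg p {{nonNegative 0≤p}} q {{nonNegative 0≤q}}}}

  -- Take u = 1/N and a current set
  -- of x > 0 vertices spanning e edges.  If γ (x u)² E ≤ e (supersaturation),
  -- 2e ≤ x d (handshake) and a + 1 + d ≤ x (deleting a closed neighbourhood of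
  -- a vertex of degree d), then a ≤ (1 - γ · 2E u · u) x.
  deletion-shrinks : ∀ (γ u E x e d a : ℚ) → 0ℚ < x →
    γ * (((x * u) ^ℚ 2) * E) ≤ e → ℕtoℚ 2 * e ≤ x * d → a + (1ℚ + d) ≤ x →
    a ≤ (1ℚ - γ * ((ℕtoℚ 2 * E * u) * u)) * x
  deletion-shrinks γ u E x e d a 0<x supersat handshake deletion = begin
    a                                    ≡⟨ solve 2 (λ a d → a := (a :+ d) :- d) refl a d ⟩
    (a + d) - d                          ≤⟨ +-monoˡ-≤ (- d) a+d≤x ⟩
    x - d                                ≤⟨ +-monoʳ-≤ x (neg-antimono-≤ K≤d) ⟩
    x - K                                ≡⟨ solve 5 (λ g x E t u → x :- g :* t :* x :* u :* u :* E
                                                       := (con 1ℚ :- g :* ((t :* E :* u) :* u)) :* x) refl γ x E two u ⟩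
    (1ℚ - γ * ((two * E * u) * u)) * x   ∎
    where
    open ≤-Reasoning
    open ℚ-Solver
    two K : ℚ
    two = ℕtoℚ 2
    -- K is the lower bound on the degree d forced by supersaturation.
    K = γ * two * x * u * u * E
    instance
      _ : Positive x
      _ = positive 0<x
      _ : NonNegative two
      _ = nonNegative (ℕtoℚ≥0 2)
    x*K≤x*d : x * K ≤ x * d
    x*K≤x*d = begin
      x * K                                    ≡⟨ solve 5 (λ g x E t u → x :* (g :* t :* x :* u :* u :* E)
                                                    := t :* (g :* (((x :* u) :* ((x :* u) :* con 1ℚ)) :* E))) refl γ x E two u ⟩
      two * (γ * (((x * u) ^ℚ 2) * E))        ≤⟨ *-monoˡ-≤-nonNeg two supersat ⟩
      two * e                                  ≤⟨ handshake ⟩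
      x * d                                    ∎
    K≤d : K ≤ d
    K≤d = *-cancelˡ-≤-pos x x*K≤x*d
    a+d≤x : a + d ≤ x
    a+d≤x = ≤-trans (+-monoʳ-≤ a (subst (_≤ 1ℚ + d) (+-identityˡ d) (+-monoˡ-≤ d (nonNegative⁻¹ 1ℚ)))) deletion

  ⊔-scale : ∀ Q X L → Q ≤ 1ℚ → 0ℚ ≤ L → Q * (X ⊔ L) ≤ (Q * X) ⊔ L
  ⊔-scale Q X L Q≤1 0≤L with ⊔-sel X L
  ... | inj₁ X⊔L≡X rewrite X⊔L≡X = p≤p⊔q (Q * X) L
  ... | inj₂ X⊔L≡L rewrite X⊔L≡L =
    ≤-trans (*-monoʳ-≤-nonNeg L {{nonNegative 0≤L}} Q≤1) (≤-trans (≤-reflexive (*-identityˡ L)) (p≤q⊔p (Q * X) L))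

  -- The same for a quantity x ≤ (X ⊔ L) n, including the case Q < 0.
  bound-scale : ∀ Q X L n x → Q ≤ 1ℚ → 0ℚ ≤ L → 0ℚ ≤ n → 0ℚ ≤ x →
    x ≤ (X ⊔ L) * n → Q * x ≤ ((Q * X) ⊔ L) * n
  bound-scale Q X L n x Q≤1 0≤L 0≤n 0≤x x≤ with 0ℚ ≤? Q
  ... | yes 0≤Q = begin
    Q * x              ≤⟨ *-monoˡ-≤-nonNeg Q {{nonNegative 0≤Q}} x≤ ⟩
    Q * ((X ⊔ L) * n)  ≡⟨ *-assoc Q (X ⊔ L) n ⟨
    Q * (X ⊔ L) * n    ≤⟨ *-monoʳ-≤-nonNeg n {{nonNegative 0≤n}} (⊔-scale Q X L Q≤1 0≤L) ⟩
    ((Q * X) ⊔ L) * n  ∎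
    where open ≤-Reasoning
  ... | no 0≰Q = begin
    Q * x              ≤⟨ *-monoˡ-≤-nonPos Q {{nonPositive (<⇒≤ (≰⇒> 0≰Q))}} 0≤x ⟩
    Q * 0ℚ             ≡⟨ *-zeroʳ Q ⟩
    0ℚ                 ≤⟨ 0≤* (≤-trans 0≤L (p≤q⊔p (Q * X) L)) 0≤n ⟩
    ((Q * X) ⊔ L) * n  ∎
    where open ≤-Reasoning

  module SupersaturatedBound (lam gam : ℚ) (0<lam : 0ℚ < lam) (0<gam : 0ℚ < gam)
                             (N : ℕ) .{{_ : ℕ.NonZero N}} (G : Graph N) (supersat : Supersaturated lam gam G) where

    q : ℚ
    q = 1ℚ - gam * (avgDeg G * ((+ 1) / N))

    Bound : ℕ → ℕ → Set
    Bound j a = ℕtoℚ a ≤ ((q ^ℚ j) ⊔ lam) * ℕtoℚ N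

    private
      n u E : ℚ
      n = ℕtoℚ N
      u = (+ 1) / N
      E = ℕtoℚ (eG G)

      q≡ : q ≡ 1ℚ - gam * ((ℕtoℚ 2 * E * u) * u)
      q≡ = cong (λ D → 1ℚ - gam * (D * u)) (trans (/N≡*1/N (2 ℕ.* eG G)) (cong (_* u) (ℕtoℚ-* 2 (eG G))))

      q≤1 : q ≤ 1ℚ
      q≤1 = subst (_≤ 1ℚ) (sym q≡)
        (≤-trans (+-monoʳ-≤ 1ℚ (neg-antimono-≤ 0≤loss)) (≤-reflexive (+-identityʳ 1ℚ)))
        where
        0≤u : 0ℚ ≤ u
        0≤u = nonNegative⁻¹ u {{normalize-nonNeg 1 N}}
        0≤loss : 0ℚ ≤ gam * ((ℕtoℚ 2 * E * u) * u)
        0≤loss = 0≤* (<⇒≤ 0<gam) (0≤* (0≤* (0≤* (ℕtoℚ≥0 2) (ℕtoℚ≥0 (eG G))) 0≤u) 0≤u)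

    Bound-mono : ∀ j a b → a ℕ.≤ b → Bound j b → Bound j a
    Bound-mono j a b a≤b = ≤-trans (ℕtoℚ-mono a≤b)

    Bound-init : Bound 0 N
    Bound-init = ≤-trans (≤-reflexive (sym (*-identityˡ n))) (*-monoʳ-≤-nonNeg n {{nonNegative (ℕtoℚ≥0 N)}} (p≤p⊔q 1ℚ lam))

    -- A large set shrinks by the factor q (supersaturation); a small one is
    -- already below λN.
    Bound-step : ∀ j (A : Subset N) d a → Bound j ∣ A ∣ →
      2 ℕ.* eIn G A ℕ.≤ ∣ A ∣ ℕ.* d → a ℕ.+ suc d ℕ.≤ ∣ A ∣ → Bound (suc j) a
    Bound-step j A d a bound handshake deletion = by-size (lam * n ≤? x)
      where
      x : ℚ
      x = ℕtoℚ ∣ A ∣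
      by-size : Dec (lam * n ≤ x) → Bound (suc j) a
      by-size (yes large) =
        ≤-trans a≤qx (bound-scale q (q ^ℚ j) lam n x q≤1 (<⇒≤ 0<lam) (ℕtoℚ≥0 N) (ℕtoℚ≥0 ∣ A ∣) bound)
        where
        0<x : 0ℚ < x
        0<x = <-≤-trans (positive⁻¹ 1ℚ) (ℕtoℚ-mono {1} {∣ A ∣}
                (ℕ.≤-trans (ℕ.s≤s ℕ.z≤n) (subst (ℕ._≤ ∣ A ∣) (ℕ.+-suc a d) deletion)))
        a≤qx : ℕtoℚ a ≤ q * x
        a≤qx = subst (λ r → ℕtoℚ a ≤ r * x) (sym q≡)
          (deletion-shrinks gam u E x (ℕtoℚ (eIn G A)) (ℕtoℚ d) (ℕtoℚ a) 0<x
            (subst (λ s → gam * ((s ^ℚ 2) * E) ≤ ℕtoℚ (eIn G A)) (/N≡*1/N ∣ A ∣) (supersat A large))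
            (subst₂ _≤_ (ℕtoℚ-* 2 (eIn G A)) (ℕtoℚ-* ∣ A ∣ d) (ℕtoℚ-mono handshake))
            (subst (_≤ x) (trans (ℕtoℚ-+ a (suc d)) (cong (λ r → ℕtoℚ a + r) (ℕtoℚ-+ 1 d))) (ℕtoℚ-mono deletion)))
      by-size (no small) =
        ≤-trans (ℕtoℚ-mono (ℕ.≤-trans (ℕ.m≤m+n a (suc d)) deletion))
                (≤-trans (<⇒≤ (≰⇒> small)) (*-monoʳ-≤-nonNeg n {{nonNegative (ℕtoℚ≥0 N)}} (p≤q⊔p (q ^ℚ suc j) lam)))

open import Data.Nat using (ℕ; NonZero; _∸_) renaming (_≤_ to _≤ℕ_; _<_ to _<ℕ_; _*_ to _*ℕ_)
open import Data.Nat.Combinatorics using (_C_)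
open import Data.Fin.Subset using (Subset; _⊆_; _─_; _∩_; ∣_∣; ⊥)
open import Data.Integer using (+_) renaming (∣_∣ to abs)
open import Data.Rational using (ℚ; _*_; _-_; _/_; _≤_; _<_; _⊔_; 0ℚ; 1ℚ; floor)
open import Data.Product using (Σ; _×_; _,_)
open import Relation.Binary.PropositionalEquality using (_≡_)
open import Data.Nat.Properties using (<⇒≤)
open RationalBounds using (module SupersaturatedBound; floor-≥)

-- The container theorem for the size bound coming from supersaturation, with
-- m = ⌊νN⌋.
corollary4p2 : (lam gam : ℚ) → 0ℚ < lam → 0ℚ < gam →
    (N : ℕ) .{{_ : NonZero N}} → (G : Graph N) → Supersaturated lam gam G →
    (t ℓ : ℕ) → 1 ≤ℕ t → 0 <ℕ ℓ → ℓ <ℕ t →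
    let ν = ((1ℚ - gam * (avgDeg G * ((+ 1) / N))) ^ℚ ℓ) ⊔ lam in
    Σ (Subset N → Subset N) (λ P →
      ∀ (I : Subset N) → Independent G I → ∣ I ∣ ≡ t →
        Σ (Subset N) (λ L → L ⊆ I × ∣ L ∣ ≡ ℓ ×
          ℕtoℚ ∣ P L ∣ ≤ ν * ℕtoℚ N × (I ─ L) ⊆ P L × L ∩ P L ≡ ⊥))
    × numIndep G t ≤ℕ (N C ℓ) *ℕ (abs (floor (ν * ℕtoℚ N)) C (t ∸ ℓ))
corollary4p2 lam gam 0<lam 0<gam N G supersat t ℓ _ _ ℓ<t = (container , covers) , count
  where
  open SupersaturatedBound lam gam 0<lam 0<gam N G supersat
  νN : ℚ
  νN = ((q ^ℚ ℓ) ⊔ lam) * ℕtoℚ N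
  open Greedy G
  open Fingerprints Bound Bound-mono Bound-step
  open Containers Bound-init ℓ t (abs (floor νN)) (<⇒≤ ℓ<t) (λ a a≤νN → floor-≥ a νN a≤νN)
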